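{- Let $w\in S_\infty$, let $k\leq l$, and let $\eta=\eta_1+2\eta_2\in\tilde B_{k,l}(w)$ (so that $|\eta_1|+2|\eta_2|=k+l$). Then $\alpha_{\max}\geq\alpha_{\min}$ and $\beta_{\max}\geq\beta_{\min}$. Moreover, for an increasing sequence $\beta$ of $k$ integers with $\eta_2\subseteq\beta\subseteq\eta_1\cup\eta_2$, we have $\beta_{\min}\leq\beta\leq\beta_{\max}$ if and only if $\beta\in A_k(w)$ and there exists $\alpha\in A_l(w)$ with $\alpha+\beta=\eta$. Similarly, for an increasing sequence $\alpha$ of $l$ integers with $\eta_2\subseteq\alpha\subseteq\eta_1\cup\eta_2$, we have $\alpha_{\min}\leq\alpha\leq\alpha_{\max}$ if and only if $\alpha\in A_l(w)$ and there exists $\beta\in A_k(w)$ with $\alpha+\beta=\eta$.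
   Context: For $w\in S_\infty$ and $m\geq1$, $w^m$ is the increasing ordering of $w(1),\dots,w(m)$; for strictly increasing sequences of equal length, $\alpha\leq\gamma$ means entrywise $\leq$. $A_m(w)$ is the set of strictly increasing sequences $\alpha$ of $m$ positive integers with $\alpha\leq w^m$; sequences are identified with finite sets. A multi-set with multiplicities at most 2 is written $\eta=\eta_1+2\eta_2$ ($\eta_1,\eta_2$ disjoint sets of elements of multiplicity 1, 2); for sets $\alpha,\beta$, $\alpha+\beta$ is their multi-set union. $\tilde B_{k,l}(w)$ is the set of all multi-sets $\alpha+\beta$ with $\alpha\in A_l(w)$, $\beta\in A_k(w)$. $A_m^\eta(w):=\{\alpha\in A_m(w):\eta_2\subseteq\alpha\subseteq\eta_1\cup\eta_2\}$; when non-empty it has a unique element $\geq$ all its other elements. $\alpha_{\max}$ denotes this element for $A_l^\eta(w)$, $\beta_{\max}$ that for $A_k^\eta(w)$; $\beta_{\min}$ is the set with $\alpha_{\max}+\beta_{\min}=\eta$ and $\alpha_{\min}$ the set with $\alpha_{\min}+\beta_{\max}=\eta$. -}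

module Defs where

open import Data.Nat using (ℕ; zero; suc; _+_; _*_; _≤_; _<_; _≟_)
open import Data.Nat.Properties using (≤-decTotalOrder)
open import Data.List using (List; []; _∷_; map; upTo; length)
open import Data.List.Membership.Propositional using (_∈_)
open import Data.List.Relation.Unary.Linked using (Linked)
open import Data.List.Relation.Unary.All using (All)
open import Data.List.Relation.Binary.Pointwise using (Pointwise)
open import Data.Product using (Σ; ∃; _×_; _,_)
open import Data.Sum using (_⊎_)
open import Relation.Binary.PropositionalEquality using (_≡_)
open import Relation.Nullary using (yes; no)
import Data.List.Sort.InsertionSort as IS

-- S_∞ : permutations of the positive integers {1,2,...} moving only
-- finitely many points.  The value at 0 is irrelevant.

record S∞ : Set where
  field
    fun        : ℕ → ℕ
    pos        : ∀ i → 1 ≤ i → 1 ≤ fun i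
    injective  : ∀ i j → 1 ≤ i → 1 ≤ j → fun i ≡ fun j → i ≡ j
    surjective : ∀ j → 1 ≤ j → Σ ℕ (λ i → 1 ≤ i × fun i ≡ j)
    finSupp    : Σ ℕ (λ N → ∀ i → N < i → fun i ≡ i)
open S∞ public

sortℕ : List ℕ → List ℕ
sortℕ = IS.sort ≤-decTotalOrder

wSeq : S∞ → ℕ → List ℕ
wSeq w m = sortℕ (map (λ i → fun w (suc i)) (upTo m))

-- strictly increasing sequences (= finite sets)
StrictIncr : List ℕ → Set
StrictIncr = Linked _<_

_≤ₛ_ : List ℕ → List ℕ → Set
α ≤ₛ γ = Pointwise _≤_ α γ

A : S∞ → ℕ → List ℕ → Set
A w m α = StrictIncr α × All (λ x → 1 ≤ x) α × (α ≤ₛ wSeq w m)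

occ : ℕ → List ℕ → ℕ
occ x [] = 0
occ x (y ∷ ys) with x ≟ y
... | yes _ = suc (occ x ys)
... | no  _ = occ x ys

-- multi-set η = η₁ + 2η₂ given by the pair of sets (η₁ , η₂)
multη : List ℕ → List ℕ → ℕ → ℕ
multη η₁ η₂ x = occ x η₁ + 2 * occ x η₂

MSumEq : List ℕ → List ℕ → List ℕ → List ℕ → Set
MSumEq α β η₁ η₂ = ∀ x → occ x α + occ x β ≡ multη η₁ η₂ x

InB̃ : S∞ → ℕ → ℕ → List ℕ → List ℕ → Set
InB̃ w k l η₁ η₂ =
  ∃ λ α → ∃ λ β → A w l α × A w k β × MSumEq α β η₁ η₂

Between : List ℕ → List ℕ → List ℕ → Set
Between η₁ η₂ α = (∀ x → x ∈ η₂ → x ∈ α) × (∀ x → x ∈ α → x ∈ η₁ ⊎ x ∈ η₂)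

Aη : S∞ → ℕ → List ℕ → List ℕ → List ℕ → Set
Aη w m η₁ η₂ α = A w m α × Between η₁ η₂ α

IsMaxAη : S∞ → ℕ → List ℕ → List ℕ → List ℕ → Set
IsMaxAη w m η₁ η₂ γ = Aη w m η₁ η₂ γ × (∀ α → Aη w m η₁ η₂ α → α ≤ₛ γ)

-- For sets α, γ of equal size, α ≤ γ entrywise iff #{x ∈ γ : x ≤ t} ≤ #{x ∈ α : x ≤ t}
-- for every t.  If α + β = η, the sum #{x ∈ α : x ≤ t} + #{x ∈ β : x ≤ t} depends only on η,
-- so for two decompositions α + β = α' + β' = η we get β' ≤ β iff α ≤ α'.  Every β with
-- η₂ ⊆ β ⊆ η₁ ∪ η₂ has the complement α = (η₁ ∖ β) ∪ η₂, with α + β = η.  Hence βmin ≤ β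
-- iff α ≤ αmax, and as A_l(w) is closed downwards and αmax dominates A_l^η(w), this holds
-- iff α ∈ A_l(w).  Applied to the decomposition witnessing η ∈ B̃_{k,l}(w) it gives
-- βmin ≤ βmax; the α-side is symmetric.
module Submission where

open import Defs
open import Data.Nat
open import Data.Nat.Properties
open import Algebra.Properties.CommutativeSemigroup +-commutativeSemigroup using (interchange)
open import Data.Nat.ListAction using (sum)
open import Data.List using (List; []; _∷_; _++_; length; filter; upTo)
open import Data.List.Membership.Propositional using (_∈_; _∉_)
open import Data.List.Membership.Propositional.Properties using (∈-filter⁺; ∈-filter⁻; ∈-upTo⁺; ∈-++⁺ˡ; ∈-++⁺ʳ)
open import Data.List.Relation.Unary.Any using (here; there)
open import Data.List.Relation.Unary.All as All using (All; []; _∷_)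
import Data.List.Relation.Unary.AllPairs as AllPairs
import Data.List.Relation.Unary.Linked as Linked
open import Data.List.Relation.Unary.Linked.Properties using (Linked⇒AllPairs; filter⁺; applyUpTo⁺₂)
open import Data.List.Relation.Binary.Pointwise using ([]; _∷_)
open import Data.List.Relation.Binary.Pointwise.Properties using (Pointwise-length) renaming (transitive to pointwise-transitive)
open import Data.Product using (∃; _×_; _,_; proj₁; proj₂; map₂)
open import Data.Sum using (_⊎_; inj₁; inj₂; [_,_]) renaming (map to ⊎-map)
open import Function using (_∘_; id)
open import Function.Bundles using (_⇔_; mk⇔; Equivalence)
open import Function.Properties.Equivalence using () renaming (trans to ⇔-trans)
open import Relation.Binary.PropositionalEquality
  using (_≡_; _≢_; refl; sym; trans; cong; cong₂; module ≡-Reasoning)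
open import Relation.Nullary using (yes; no; contradiction)

≤ₛ-trans : ∀ {α β γ} → α ≤ₛ β → β ≤ₛ γ → α ≤ₛ γ
≤ₛ-trans = pointwise-transitive ≤-trans

head-< : ∀ {x xs} → StrictIncr (x ∷ xs) → All (x <_) xs
head-< = AllPairs.head ∘ Linked⇒AllPairs <-trans

∈⇒≤sum : ∀ {z xs} → z ∈ xs → z ≤ sum xs
∈⇒≤sum {xs = y ∷ ys} (here refl)  = m≤m+n y (sum ys)
∈⇒≤sum {xs = y ∷ ys} (there z∈ys) = ≤-trans (∈⇒≤sum z∈ys) (m≤n+m (sum ys) y)

occ-head : ∀ y ys → occ y (y ∷ ys) ≡ suc (occ y ys)
occ-head y ys with y ≟ y
... | yes _   = refl
... | no y≢y  = contradiction refl y≢y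

occ-≢ : ∀ {x y} ys → x ≢ y → occ x (y ∷ ys) ≡ occ x ys
occ-≢ {x} {y} ys x≢y with x ≟ y
... | yes x≡y = contradiction x≡y x≢y
... | no _    = refl

occ-∷ : ∀ x y ys → occ x (y ∷ ys) ≡ occ x (y ∷ []) + occ x ys
occ-∷ x y ys with x ≟ y
... | yes _ = refl
... | no _  = refl

∈⇒occ>0 : ∀ {z xs} → z ∈ xs → 0 < occ z xs
∈⇒occ>0 {z} {y ∷ ys} z∈xs with z ≟ y | z∈xs
... | yes _   | _           = z<s
... | no z≢y  | here z≡y    = contradiction z≡y z≢y
... | no _    | there z∈ys  = ∈⇒occ>0 z∈ys

occ>0⇒∈ : ∀ {z xs} → 0 < occ z xs → z ∈ xs
occ>0⇒∈ {z} {y ∷ ys} occ>0 with z ≟ y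
... | yes z≡y = here z≡y
... | no _    = there (occ>0⇒∈ occ>0)

∉⇒occ≡0 : ∀ {z xs} → z ∉ xs → occ z xs ≡ 0
∉⇒occ≡0 z∉xs = n≤0⇒n≡0 (≮⇒≥ (z∉xs ∘ occ>0⇒∈))

occ≡0⇒∉ : ∀ {z xs} → occ z xs ≡ 0 → z ∉ xs
occ≡0⇒∉ occ≡0 z∈xs = <-irrefl (sym occ≡0) (∈⇒occ>0 z∈xs)

strict⇒occ≤1 : ∀ {xs} → StrictIncr xs → ∀ z → occ z xs ≤ 1
strict⇒occ≤1 {[]}     _      z = z≤n
strict⇒occ≤1 {y ∷ ys} strict z with z ≟ y
... | yes refl = s≤s (≤-reflexive (∉⇒occ≡0 λ z∈ys → <-irrefl refl (All.lookup (head-< strict) z∈ys)))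
... | no _     = strict⇒occ≤1 (Linked.tail strict) z

occ≤-by-∈ : ∀ {z xs n} → occ z xs ≤ 1 → (z ∈ xs → 0 < n) → occ z xs ≤ n
occ≤-by-∈ occ≤1 n>0 with m≤n⇒m<n∨m≡n occ≤1
... | inj₁ occ<1 = ≤-trans (≤-reflexive (n<1⇒n≡0 occ<1)) z≤n
... | inj₂ occ≡1 = ≤-trans (≤-reflexive occ≡1) (n>0 (occ>0⇒∈ (≤-reflexive (sym occ≡1))))

All-pos⇒occ0≡0 : ∀ {xs} → All (1 ≤_) xs → occ 0 xs ≡ 0
All-pos⇒occ0≡0 pos = ∉⇒occ≡0 λ 0∈xs → <-irrefl refl (All.lookup pos 0∈xs)

occ0≡0⇒All-pos : ∀ {xs} → occ 0 xs ≡ 0 → All (1 ≤_) xs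
occ0≡0⇒All-pos occ≡0 = All.tabulate λ z∈xs → n≢0⇒n>0 λ { refl → occ≡0⇒∉ occ≡0 z∈xs }

sumTo : ℕ → (ℕ → ℕ) → ℕ
sumTo zero    f = f 0
sumTo (suc t) f = sumTo t f + f (suc t)

sumTo-cong : ∀ t {f g : ℕ → ℕ} → (∀ x → f x ≡ g x) → sumTo t f ≡ sumTo t g
sumTo-cong zero    f≗g = f≗g 0
sumTo-cong (suc t) f≗g = cong₂ _+_ (sumTo-cong t f≗g) (f≗g (suc t))

sumTo-+ : ∀ t (f g : ℕ → ℕ) → sumTo t (λ x → f x + g x) ≡ sumTo t f + sumTo t g
sumTo-+ zero    f g = refl
sumTo-+ (suc t) f g =
  trans (cong (_+ (f (suc t) + g (suc t))) (sumTo-+ t f g)) (interchange (sumTo t f) (sumTo t g) _ _)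

sumTo-*ˡ : ∀ t c (f : ℕ → ℕ) → sumTo t (λ x → c * f x) ≡ c * sumTo t f
sumTo-*ˡ zero    c f = refl
sumTo-*ˡ (suc t) c f = trans (cong (_+ c * f (suc t)) (sumTo-*ˡ t c f)) (sym (*-distribˡ-+ c (sumTo t f) _))

count≤ : ℕ → List ℕ → ℕ
count≤ t xs = sumTo t (λ x → occ x xs)

count≤-[] : ∀ t → count≤ t [] ≡ 0
count≤-[] zero    = refl
count≤-[] (suc t) = cong (_+ 0) (count≤-[] t)

count≤-∷ : ∀ t {y ys} → count≤ t (y ∷ ys) ≡ count≤ t (y ∷ []) + count≤ t ys
count≤-∷ t {y} {ys} = trans (sumTo-cong t λ x → occ-∷ x y ys) (sumTo-+ t _ _)

count≤-single-> : ∀ t {y} → t < y → count≤ t (y ∷ []) ≡ 0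
count≤-single-> zero    t<y = occ-≢ [] (<⇒≢ t<y)
count≤-single-> (suc t) t<y = cong₂ _+_ (count≤-single-> t (<-trans (n<1+n t) t<y)) (occ-≢ [] (<⇒≢ t<y))

count≤-single-≤ : ∀ t {y} → y ≤ t → count≤ t (y ∷ []) ≡ 1
count≤-single-≤ zero    z≤n     = occ-head 0 []
count≤-single-≤ (suc t) y≤1+t with m≤n⇒m<n∨m≡n y≤1+t
... | inj₁ y<1+t = cong₂ _+_ (count≤-single-≤ t (s≤s⁻¹ y<1+t)) (occ-≢ [] (>⇒≢ y<1+t))
... | inj₂ refl  = cong₂ _+_ (count≤-single-> t (n<1+n t)) (occ-head (suc t) [])

count≤-single-antitone : ∀ t {x y} → x ≤ y → count≤ t (y ∷ []) ≤ count≤ t (x ∷ [])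
count≤-single-antitone t {x} {y} x≤y with y ≤? t
... | yes y≤t = ≤-reflexive (trans (count≤-single-≤ t y≤t) (sym (count≤-single-≤ t (≤-trans x≤y y≤t))))
... | no y≰t  = ≤-trans (≤-reflexive (count≤-single-> t (≰⇒> y≰t))) z≤n

count≤-∷-≤ : ∀ t {y ys} → y ≤ t → count≤ t (y ∷ ys) ≡ suc (count≤ t ys)
count≤-∷-≤ t y≤t = trans (count≤-∷ t) (cong (_+ _) (count≤-single-≤ t y≤t))

count≤-∷-> : ∀ t {y ys} → t < y → count≤ t (y ∷ ys) ≡ count≤ t ys
count≤-∷-> t t<y = trans (count≤-∷ t) (cong (_+ _) (count≤-single-> t t<y))

count≤-tail : ∀ t {y ys} → count≤ t ys ≤ count≤ t (y ∷ ys)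
count≤-tail t = ≤-trans (m≤n+m _ _) (≤-reflexive (sym (count≤-∷ t)))

count≤-all> : ∀ t {xs} → All (t <_) xs → count≤ t xs ≡ 0
count≤-all> t []           = count≤-[] t
count≤-all> t (t<y ∷ t<ys) = trans (count≤-∷-> t t<y) (count≤-all> t t<ys)

count≤-below-head : ∀ t {y ys} → StrictIncr (y ∷ ys) → t < y → count≤ t (y ∷ ys) ≡ 0
count≤-below-head t strict t<y = count≤-all> t (t<y ∷ All.map (<-trans t<y) (head-< strict))

count≤-length : ∀ t {xs} → All (_≤ t) xs → count≤ t xs ≡ length xs
count≤-length t []           = count≤-[] t
count≤-length t (y≤t ∷ ys≤t) = trans (count≤-∷-≤ t y≤t) (cong suc (count≤-length t ys≤t))

≤ₛ⇒count≤-≥ : ∀ {α γ} → α ≤ₛ γ → ∀ t → count≤ t γ ≤ count≤ t α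
≤ₛ⇒count≤-≥ []                              t = ≤-refl
≤ₛ⇒count≤-≥ {x ∷ α} {y ∷ γ} (x≤y ∷ α≤γ) t = begin
  count≤ t (y ∷ γ)                  ≡⟨ count≤-∷ t ⟩
  count≤ t (y ∷ []) + count≤ t γ    ≤⟨ +-mono-≤ (count≤-single-antitone t x≤y) (≤ₛ⇒count≤-≥ α≤γ t) ⟩
  count≤ t (x ∷ []) + count≤ t α    ≡⟨ count≤-∷ t ⟨
  count≤ t (x ∷ α)                  ∎
  where open ≤-Reasoning

count≤-≥⇒≤ₛ : ∀ {α γ} → StrictIncr α → StrictIncr γ → length α ≡ length γ →
              (∀ t → count≤ t γ ≤ count≤ t α) → α ≤ₛ γ
count≤-≥⇒≤ₛ {[]}    {[]}    _ _ _ _ = []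
count≤-≥⇒≤ₛ {x ∷ α} {y ∷ γ} α-strict γ-strict |α|≡|γ| counts =
  x≤y ∷ count≤-≥⇒≤ₛ (Linked.tail α-strict) (Linked.tail γ-strict) (suc-injective |α|≡|γ|) tail-counts
  where
  x≤y : x ≤ y
  x≤y = ≮⇒≥ λ y<x → 1+n≰n (begin
    1                  ≤⟨ s≤s z≤n ⟩
    suc (count≤ y γ)   ≡⟨ count≤-∷-≤ y ≤-refl ⟨
    count≤ y (y ∷ γ)   ≤⟨ counts y ⟩
    count≤ y (x ∷ α)   ≡⟨ count≤-below-head y α-strict y<x ⟩
    0                  ∎)
    where open ≤-Reasoning
  tail-counts : ∀ t → count≤ t γ ≤ count≤ t α
  tail-counts t with y ≤? t
  ... | yes y≤t = s≤s⁻¹ (begin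
    suc (count≤ t γ)  ≡⟨ count≤-∷-≤ t y≤t ⟨
    count≤ t (y ∷ γ)  ≤⟨ counts t ⟩
    count≤ t (x ∷ α)  ≡⟨ count≤-∷-≤ t (≤-trans x≤y y≤t) ⟩
    suc (count≤ t α)  ∎)
    where open ≤-Reasoning
  ... | no y≰t  = ≤-trans (count≤-tail t) (≤-trans (≤-reflexive (count≤-below-head t γ-strict (≰⇒> y≰t))) z≤n)

support : (ℕ → ℕ) → ℕ → List ℕ
support f N = filter (λ z → f z ≟ 1) (upTo N)

support-strict : ∀ f N → StrictIncr (support f N)
support-strict f N = filter⁺ (λ z → f z ≟ 1) <-trans (applyUpTo⁺₂ id N n<1+n)

occ-support : ∀ f N → (∀ z → f z ≤ 1) → (∀ z → 0 < f z → z < N) → ∀ z → occ z (support f N) ≡ f z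
occ-support f N f≤1 f-bounded z with m≤n⇒m<n∨m≡n (f≤1 z)
... | inj₁ fz<1 = trans (∉⇒occ≡0 z∉) (sym (n<1⇒n≡0 fz<1))
  where
  z∉ : z ∉ support f N
  z∉ z∈ = <-irrefl (proj₂ (∈-filter⁻ (λ z → f z ≟ 1) {xs = upTo N} z∈)) fz<1
... | inj₂ fz≡1 = trans (≤-antisym (strict⇒occ≤1 (support-strict f N) z) (∈⇒occ>0 z∈)) (sym fz≡1)
  where
  z∈ : z ∈ support f N
  z∈ = ∈-filter⁺ (λ z → f z ≟ 1) (∈-upTo⁺ (f-bounded z (≤-reflexive (sym fz≡1)))) fz≡1

module Decomposition (η₁ η₂ : List ℕ) where

  MSumEq-comm : ∀ α β → MSumEq α β η₁ η₂ → MSumEq β α η₁ η₂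
  MSumEq-comm α β α+β x = trans (+-comm (occ x β) (occ x α)) (α+β x)

  count≤-MSumEq : ∀ α β → MSumEq α β η₁ η₂ →
                  ∀ t → count≤ t α + count≤ t β ≡ count≤ t η₁ + 2 * count≤ t η₂
  count≤-MSumEq α β α+β t = begin
    count≤ t α + count≤ t β                      ≡⟨ sumTo-+ t _ _ ⟨
    sumTo t (λ x → occ x α + occ x β)            ≡⟨ sumTo-cong t α+β ⟩
    sumTo t (multη η₁ η₂)                        ≡⟨ sumTo-+ t _ _ ⟩
    count≤ t η₁ + sumTo t (λ x → 2 * occ x η₂)   ≡⟨ cong (count≤ t η₁ +_) (sumTo-*ˡ t 2 _) ⟩
    count≤ t η₁ + 2 * count≤ t η₂                ∎
    where open ≡-Reasoning

  MSumEq-length : ∀ α β → MSumEq α β η₁ η₂ → length α + length β ≡ length η₁ + 2 * length η₂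
  MSumEq-length α β α+β = begin
    length α + length β             ≡⟨ cong₂ _+_ (count≤-T α ∈-++⁺ˡ) (count≤-T β (∈-++⁺ʳ α ∘ ∈-++⁺ˡ)) ⟨
    count≤ T α + count≤ T β         ≡⟨ count≤-MSumEq α β α+β T ⟩
    count≤ T η₁ + 2 * count≤ T η₂   ≡⟨ cong₂ (λ a b → a + 2 * b)
                                             (count≤-T η₁ (∈-++⁺ʳ α ∘ ∈-++⁺ʳ β ∘ ∈-++⁺ˡ))
                                             (count≤-T η₂ (∈-++⁺ʳ α ∘ ∈-++⁺ʳ β ∘ ∈-++⁺ʳ η₁)) ⟩
    length η₁ + 2 * length η₂       ∎
    where
    open ≡-Reasoning
    T : ℕ
    T = sum (α ++ β ++ η₁ ++ η₂)
    count≤-T : ∀ xs → (∀ {z} → z ∈ xs → z ∈ α ++ β ++ η₁ ++ η₂) → count≤ T xs ≡ length xs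
    count≤-T xs ⊆all = count≤-length T (All.tabulate (∈⇒≤sum ∘ ⊆all))

  exchange-≤ₛ : ∀ {α β γ δ} → StrictIncr α → StrictIncr γ →
                MSumEq α β η₁ η₂ → MSumEq γ δ η₁ η₂ → δ ≤ₛ β → α ≤ₛ γ
  exchange-≤ₛ {α} {β} {γ} {δ} α-strict γ-strict α+β γ+δ δ≤β =
    count≤-≥⇒≤ₛ α-strict γ-strict |α|≡|γ| counts
    where
    |α|≡|γ| : length α ≡ length γ
    |α|≡|γ| = +-cancelʳ-≡ (length β) (length α) (length γ) (begin
      length α + length β   ≡⟨ trans (MSumEq-length α β α+β) (sym (MSumEq-length γ δ γ+δ)) ⟩
      length γ + length δ   ≡⟨ cong (length γ +_) (Pointwise-length δ≤β) ⟩
      length γ + length β   ∎)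
      where open ≡-Reasoning
    counts : ∀ t → count≤ t γ ≤ count≤ t α
    counts t = +-cancelʳ-≤ (count≤ t β) (count≤ t γ) (count≤ t α) (begin
      count≤ t γ + count≤ t β   ≤⟨ +-monoʳ-≤ (count≤ t γ) (≤ₛ⇒count≤-≥ δ≤β t) ⟩
      count≤ t γ + count≤ t δ   ≡⟨ trans (count≤-MSumEq γ δ γ+δ t) (sym (count≤-MSumEq α β α+β t)) ⟩
      count≤ t α + count≤ t β   ∎)
      where open ≤-Reasoning

  mult>0⇒∈ : ∀ z → 0 < multη η₁ η₂ z → z ∈ η₁ ⊎ z ∈ η₂
  mult>0⇒∈ z mult>0 = ⊎-map occ>0⇒∈ occ>0⇒∈ (summand>0 (occ z η₁) (occ z η₂) mult>0)
    where
    summand>0 : ∀ a b → 0 < a + 2 * b → 0 < a ⊎ 0 < b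
    summand>0 (suc _) _       _ = inj₁ z<s
    summand>0 zero    (suc _) _ = inj₂ z<s

  ∈⇒mult>0 : ∀ z → z ∈ η₁ ⊎ z ∈ η₂ → 0 < multη η₁ η₂ z
  ∈⇒mult>0 z = [ (λ z∈η₁ → ≤-trans (∈⇒occ>0 z∈η₁) (m≤m+n _ _))
               , (λ z∈η₂ → ≤-trans (∈⇒occ>0 z∈η₂) (≤-trans (m≤n*m _ 2) (m≤n+m _ (occ z η₁)))) ]

  MSumEq⇒Between : ∀ α {β} → StrictIncr β → MSumEq α β η₁ η₂ → Between η₁ η₂ α
  MSumEq⇒Between α {β} β-strict α+β = η₂⊆α , α⊆η
    where
    left>0 : ∀ a {b} → b ≤ 1 → 2 ≤ a + b → 0 < a
    left>0 zero    b≤1 2≤b = contradiction (≤-trans 2≤b b≤1) λ { (s≤s ()) }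
    left>0 (suc _) _   _   = z<s
    η₂⊆α : ∀ z → z ∈ η₂ → z ∈ α
    η₂⊆α z z∈η₂ = occ>0⇒∈ (left>0 (occ z α) (strict⇒occ≤1 β-strict z) (begin
      2                   ≤⟨ *-monoʳ-≤ 2 (∈⇒occ>0 z∈η₂) ⟩
      2 * occ z η₂        ≤⟨ m≤n+m _ (occ z η₁) ⟩
      multη η₁ η₂ z       ≡⟨ α+β z ⟨
      occ z α + occ z β   ∎))
      where open ≤-Reasoning
    α⊆η : ∀ z → z ∈ α → z ∈ η₁ ⊎ z ∈ η₂
    α⊆η z z∈α = mult>0⇒∈ z (≤-trans (≤-trans (∈⇒occ>0 z∈α) (m≤m+n _ _)) (≤-reflexive (α+β z)))

  MSumEq-sets⇒mult≤2 : ∀ {α β} → StrictIncr α → StrictIncr β → MSumEq α β η₁ η₂ →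
                       ∀ z → multη η₁ η₂ z ≤ 2
  MSumEq-sets⇒mult≤2 α-strict β-strict α+β z =
    ≤-trans (≤-reflexive (sym (α+β z))) (+-mono-≤ (strict⇒occ≤1 α-strict z) (strict⇒occ≤1 β-strict z))

  summand-positive : ∀ α β → multη η₁ η₂ 0 ≡ 0 → MSumEq α β η₁ η₂ → All (1 ≤_) α
  summand-positive α β η0≡0 α+β = occ0≡0⇒All-pos (m+n≡0⇒m≡0 (occ 0 α) (trans (α+β 0) η0≡0))

  positive-summands⇒mult0≡0 : ∀ {α β} → All (1 ≤_) α → All (1 ≤_) β → MSumEq α β η₁ η₂ →
                            multη η₁ η₂ 0 ≡ 0
  positive-summands⇒mult0≡0 α-pos β-pos α+β =
    trans (sym (α+β 0)) (cong₂ _+_ (All-pos⇒occ0≡0 α-pos) (All-pos⇒occ0≡0 β-pos))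

  complement : ∀ {y} → StrictIncr η₁ → StrictIncr η₂ → (∀ z → multη η₁ η₂ z ≤ 2) →
               StrictIncr y → Between η₁ η₂ y → ∃ λ x → StrictIncr x × MSumEq x y η₁ η₂
  complement {y} η₁-strict η₂-strict η≤2 y-strict (η₂⊆y , y⊆η) =
    support excess N , support-strict excess N , x+y
    where
    -- pointwise η − y is the indicator of (η₁ ∖ y) ∪ η₂
    excess : ℕ → ℕ
    excess z = multη η₁ η₂ z ∸ occ z y
    N : ℕ
    N = suc (sum (η₁ ++ η₂))
    y≤η : ∀ z → occ z y ≤ multη η₁ η₂ z
    y≤η z = occ≤-by-∈ (strict⇒occ≤1 y-strict z) (∈⇒mult>0 z ∘ y⊆η z)
    excess≤1 : ∀ z → excess z ≤ 1
    excess≤1 z = excess≤1-arith (occ z η₁) (occ z η₂) (occ z y) (η≤2 z) (strict⇒occ≤1 η₁-strict z)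
                   (strict⇒occ≤1 y-strict z) (occ≤-by-∈ (strict⇒occ≤1 η₂-strict z) (∈⇒occ>0 ∘ η₂⊆y z))
      where
      excess≤1-arith : ∀ e₁ e₂ o → e₁ + 2 * e₂ ≤ 2 → e₁ ≤ 1 → o ≤ 1 → e₂ ≤ o → e₁ + 2 * e₂ ∸ o ≤ 1
      excess≤1-arith e₁ zero    o             _   e₁≤1 _        _  =
        ≤-trans (m∸n≤m (e₁ + 0) o) (≤-trans (≤-reflexive (+-identityʳ e₁)) e₁≤1)
      excess≤1-arith e₁ (suc _) (suc zero)    η≤2 _    _        _  = ∸-monoˡ-≤ 1 η≤2
      excess≤1-arith e₁ (suc _) (suc (suc _)) _   _    (s≤s ()) _
    excess-bounded : ∀ z → 0 < excess z → z < N
    excess-bounded z excess>0 =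
      s≤s (∈⇒≤sum {xs = η₁ ++ η₂} ([ ∈-++⁺ˡ , ∈-++⁺ʳ η₁ ] (mult>0⇒∈ z (≤-trans excess>0 (m∸n≤m _ (occ z y))))))
    x+y : MSumEq (support excess N) y η₁ η₂
    x+y z = trans (cong (_+ occ z y) (occ-support excess N excess≤1 excess-bounded z)) (m∸n+n≡m (y≤η z))

  module Interval (w : S∞) (m n : ℕ) (η₁-strict : StrictIncr η₁) (η₂-strict : StrictIncr η₂)
               (η∈B̃ : InB̃ w n m η₁ η₂) {xmax ymax ymin : List ℕ}
               (xmax-isMax : IsMaxAη w m η₁ η₂ xmax) (ymax-isMax : IsMaxAη w n η₁ η₂ ymax)
               (ymin-strict : StrictIncr ymin) (xmax+ymin : MSumEq xmax ymin η₁ η₂) where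

    η≤2 : ∀ z → multη η₁ η₂ z ≤ 2
    η≤2 = let (_ , _ , (x₀-strict , _) , (y₀-strict , _) , x₀+y₀) = η∈B̃
          in MSumEq-sets⇒mult≤2 x₀-strict y₀-strict x₀+y₀

    η0≡0 : multη η₁ η₂ 0 ≡ 0
    η0≡0 = let (_ , _ , (_ , x₀-pos , _) , (_ , y₀-pos , _) , x₀+y₀) = η∈B̃
           in positive-summands⇒mult0≡0 x₀-pos y₀-pos x₀+y₀

    xmax-strict : StrictIncr xmax
    xmax-strict = proj₁ (proj₁ (proj₁ xmax-isMax))

    xmax≤wᵐ : xmax ≤ₛ wSeq w m
    xmax≤wᵐ = proj₂ (proj₂ (proj₁ (proj₁ xmax-isMax)))

    ymax≤wⁿ : ymax ≤ₛ wSeq w n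
    ymax≤wⁿ = proj₂ (proj₂ (proj₁ (proj₁ ymax-isMax)))

    interval⇔decomposable : ∀ y → StrictIncr y → Between η₁ η₂ y →
            ((ymin ≤ₛ y) × (y ≤ₛ ymax)) ⇔ (A w n y × ∃ λ x → A w m x × MSumEq x y η₁ η₂)
    interval⇔decomposable y y-strict y-between = mk⇔ to from
      where
      to : (ymin ≤ₛ y) × (y ≤ₛ ymax) → A w n y × ∃ λ x → A w m x × MSumEq x y η₁ η₂
      to (ymin≤y , y≤ymax) =
        let (x , x-strict , x+y) = complement η₁-strict η₂-strict η≤2 y-strict y-between
            x≤xmax = exchange-≤ₛ x-strict xmax-strict x+y xmax+ymin ymin≤y
        in (y-strict , summand-positive y x η0≡0 (MSumEq-comm x y x+y) , ≤ₛ-trans y≤ymax ymax≤wⁿ) ,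
           x , (x-strict , summand-positive x y η0≡0 x+y , ≤ₛ-trans x≤xmax xmax≤wᵐ) , x+y
      from : A w n y × ∃ (λ x → A w m x × MSumEq x y η₁ η₂) → (ymin ≤ₛ y) × (y ≤ₛ ymax)
      from (y∈A , x , x∈A , x+y) =
        let x≤xmax = proj₂ xmax-isMax x (x∈A , MSumEq⇒Between x y-strict x+y)
        in exchange-≤ₛ ymin-strict y-strict (MSumEq-comm xmax ymin xmax+ymin) (MSumEq-comm x y x+y) x≤xmax ,
           proj₂ ymax-isMax y (y∈A , y-between)

    ymin≤ymax : ymin ≤ₛ ymax
    ymin≤ymax =
      let (x₀ , y₀ , x₀∈A , y₀∈A , x₀+y₀) = η∈B̃
          (ymin≤y₀ , y₀≤ymax) = Equivalence.from
            (interval⇔decomposable y₀ (proj₁ y₀∈A) (MSumEq⇒Between y₀ (proj₁ x₀∈A) (MSumEq-comm x₀ y₀ x₀+y₀)))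
            (y₀∈A , x₀ , x₀∈A , x₀+y₀)
      in ≤ₛ-trans ymin≤y₀ y₀≤ymax

corollary2p9 : (w : S∞) (k l : ℕ) → k ≤ l →
    (η₁ η₂ : List ℕ) → StrictIncr η₁ → StrictIncr η₂ → InB̃ w k l η₁ η₂ →
    (αmax βmax αmin βmin : List ℕ) →
    IsMaxAη w l η₁ η₂ αmax → IsMaxAη w k η₁ η₂ βmax →
    StrictIncr βmin → MSumEq αmax βmin η₁ η₂ →
    StrictIncr αmin → MSumEq αmin βmax η₁ η₂ →
    ((αmin ≤ₛ αmax) × (βmin ≤ₛ βmax))
    × (∀ β → StrictIncr β → length β ≡ k → Between η₁ η₂ β →
         ((βmin ≤ₛ β) × (β ≤ₛ βmax))
         ⇔ (A w k β × ∃ (λ α → A w l α × MSumEq α β η₁ η₂)))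
    × (∀ α → StrictIncr α → length α ≡ l → Between η₁ η₂ α →
         ((αmin ≤ₛ α) × (α ≤ₛ αmax))
         ⇔ (A w l α × ∃ (λ β → A w k β × MSumEq α β η₁ η₂)))
corollary2p9 w k l _ η₁ η₂ η₁-strict η₂-strict η∈B̃@(α₀ , β₀ , α₀∈A , β₀∈A , α₀+β₀) αmax βmax αmin βmin
             αmax-isMax βmax-isMax βmin-strict αmax+βmin αmin-strict αmin+βmax =
  (Sα.ymin≤ymax , Sβ.ymin≤ymax) ,
  (λ β β-strict _ β-between → Sβ.interval⇔decomposable β β-strict β-between) ,
  (λ α α-strict _ α-between → ⇔-trans (Sα.interval⇔decomposable α α-strict α-between) (swap-summands α))
  where
  open Decomposition η₁ η₂
  module Sβ = Interval w l k η₁-strict η₂-strict η∈B̃ αmax-isMax βmax-isMax βmin-strict αmax+βmin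
  module Sα = Interval w k l η₁-strict η₂-strict (β₀ , α₀ , β₀∈A , α₀∈A , MSumEq-comm α₀ β₀ α₀+β₀)
                    βmax-isMax αmax-isMax αmin-strict (MSumEq-comm αmin βmax αmin+βmax)
  swap-summands : ∀ α → (A w l α × ∃ λ β → A w k β × MSumEq β α η₁ η₂)
                        ⇔ (A w l α × ∃ λ β → A w k β × MSumEq α β η₁ η₂)
  swap-summands α = mk⇔ (map₂ λ { (β , β∈A , β+α) → β , β∈A , MSumEq-comm β α β+α })
                        (map₂ λ { (β , β∈A , α+β) → β , β∈A , MSumEq-comm α β α+β })
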